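{- If either $m\ge 5$ and $n=3$, or $m\ge n\ge 4$, then $t_2(K_m\,\square\,K_n)=2$ and $b_2(K_m\,\square\,K_n)=5$.
   Context: $K_m$ is the complete graph on $m$ vertices. The Cartesian product $G\,\square\,H$ has vertex set $V(G)\times V(H)$, with $(u_1,v_1)$ adjacent to $(u_2,v_2)$ iff either $u_1=u_2$ and $v_1v_2\in E(H)$, or $v_1=v_2$ and $u_1u_2\in E(G)$. The 2-burning process: given a graph $G$ and a sequence $s=(s_1,\dots,s_k)$ of vertices of $G$ (sources), at round $0$ all vertices are uncolored; at each round $j\ge1$, (i) if $j\le k$ and $s_j$ is uncolored, $s_j$ is colored blue, and (ii) every uncolored vertex having at least two neighbors that were blue at the end of round $j-1$ is colored blue. $s$ is a 2-burning sequence if eventually all vertices are blue; $\mathrm{len}(s)=k$ and $\mathrm{rd}(s)$ is the first round at the end of which all vertices are blue. $b_2(G)$ is the minimum of $\mathrm{rd}(s)$ over all 2-burning sequences; a 2-burning sequence achieving it is optimal; $t_2(G)$ is the minimum length of an optimal 2-burning sequence. -}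

module Defs where

open import Data.Bool using (Bool; true; false; _∨_; _∧_; not)
open import Data.Nat using (ℕ; zero; suc; _≤_; _<_; _≤ᵇ_)
open import Data.Fin using (Fin)
open import Data.Fin.Properties using () renaming (_≟_ to _≟ᶠ_)
open import Data.List using (List; []; _∷_; length; filter; cartesianProduct)
open import Data.List using (allFin) public
open import Data.Maybe using (Maybe; just; nothing; maybe)
open import Data.Product using (Σ; _×_; _,_; ∃)
open import Relation.Binary.Definitions using (DecidableEquality)
open import Relation.Binary.PropositionalEquality using (_≡_)
open import Relation.Nullary using (¬_)
open import Relation.Nullary.Decidable using (⌊_⌋)
open import Data.Product.Properties using (≡-dec)
open import Data.Bool.Properties using () renaming (_≟_ to _≟B_)

-- A finite simple graph: vertex type with decidable equality,
-- a duplicate-free complete enumeration of vertices, and a Boolean adjacency.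
record FinGraph : Set₁ where
  field
    V     : Set
    _≟V_  : DecidableEquality V
    verts : List V
    adj   : V → V → Bool

KK : ℕ → ℕ → FinGraph
KK m n = record
  { V     = Fin m × Fin n
  ; _≟V_  = ≡-dec _≟ᶠ_ _≟ᶠ_
  ; verts = cartesianProduct (allFin m) (allFin n)
  ; adj   = λ { (u₁ , v₁) (u₂ , v₂) →
               (⌊ u₁ ≟ᶠ u₂ ⌋ ∧ not ⌊ v₁ ≟ᶠ v₂ ⌋)
             ∨ (⌊ v₁ ≟ᶠ v₂ ⌋ ∧ not ⌊ u₁ ≟ᶠ u₂ ⌋) }
  }

module _ (G : FinGraph) where
  open FinGraph G

  -- the j-th source (1-indexed), if j ≤ length s
  srcAt : List V → ℕ → Maybe V
  srcAt []       _             = nothing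
  srcAt (x ∷ xs) zero          = nothing
  srcAt (x ∷ xs) (suc zero)    = just x
  srcAt (x ∷ xs) (suc (suc j)) = srcAt xs (suc j)

  isSourceAt : List V → ℕ → V → Bool
  isSourceAt s j v = maybe (λ x → ⌊ x ≟V v ⌋) false (srcAt s j)

  blueNbrs : (V → Bool) → V → ℕ
  blueNbrs B v = length (filter (λ u → (adj v u ∧ B u) ≟B true) verts)

  -- blue s j v : v is blue at the end of round j of the 2-burning process with sources s
  blue : List V → ℕ → V → Bool
  blue s zero    v = false
  blue s (suc j) v = blue s j v ∨ isSourceAt s (suc j) v ∨ (2 ≤ᵇ blueNbrs (blue s j) v)

  AllBlue : List V → ℕ → Set
  AllBlue s r = ∀ v → blue s r v ≡ true

  IsRd : List V → ℕ → Set
  IsRd s r = AllBlue s r × (∀ r' → r' < r → ¬ AllBlue s r')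

  IsB2 : ℕ → Set
  IsB2 b = (∃ λ s → IsRd s b) × (∀ s r → IsRd s r → b ≤ r)

  Optimal : ℕ → List V → Set
  Optimal b s = IsRd s b

  IsT2 : ℕ → ℕ → Set
  IsT2 b t = (∃ λ s → Optimal b s × length s ≡ t) × (∀ s → Optimal b s → t ≤ length s)

-- Upper bound: with the sources (a₀ , b₀) and (a₁ , b₁) on a diagonal, the 2×2 square they span is
-- blue after round 3, the two rows through it after round 4, and every vertex after round 5, as it
-- sees the blue vertices of its column in those two rows.
-- Lower bound: after round 3 only the first three sources and the common neighbours of the first
-- two can be blue, and apart from the third source they all lie in one row, in one column, or on
-- the 2×2 square spanned by the first two sources. In a large enough grid some vertex avoids all of
-- them and the fourth source and sees at most one of them, so it is still white after round 4.
-- A lone source never spreads, since spreading needs two blue neighbours; hence t₂ = 2.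
module Submission where

open import Defs
open import Data.Bool using (Bool; true; false; _∨_; _∧_)
open import Data.Bool.Properties using (∨-zeroʳ; ∧-conicalˡ; ∧-conicalʳ; T-≡) renaming (_≟_ to _≟ᴮ_)
open import Data.Empty using (⊥-elim)
open import Data.Fin using (Fin; zero; suc; fromℕ<)
open import Data.Fin.Properties using (_≟_; ¬∀⟶∃¬; injective⇒≤)
open import Data.List using (List; []; _∷_; length; filter; lookup)
open import Data.List.Membership.Propositional using (_∈_)
open import Data.List.Membership.Propositional.Properties using (∈-filter⁺; ∈-filter⁻; ∈-cartesianProduct⁺; ∈-allFin)
open import Data.List.Relation.Unary.All using (All; []; _∷_)
open import Data.List.Relation.Unary.All.Properties using (¬Any⇒All¬)
open import Data.List.Relation.Unary.AllPairs using (_∷_)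
open import Data.List.Relation.Unary.Any as Any using (here; there)
open import Data.List.Relation.Unary.Any.Properties using (lookup-index)
open import Data.List.Relation.Unary.Unique.Propositional using (Unique)
open import Data.List.Relation.Unary.Unique.Propositional.Properties using (filter⁺; allFin⁺; cartesianProduct⁺)
open import Data.Maybe using (just; fromMaybe)
open import Data.Maybe.Properties using (just-injective)
open import Data.Nat using (ℕ; zero; suc; _≤_; _<_; _≤ᵇ_; z≤n; s≤s; _≤′_; ≤′-refl; ≤′-step)
open import Data.Nat.Properties using (≤-refl; ≤-trans; ≤-pred; <⇒≤; <⇒≱; ≮⇒≥; n≤1+n; m≤m+n; ≤ᵇ⇒≤; ≤⇒≤ᵇ; ≤⇒≤′)
open import Data.Product using (_×_; ∃; ∃₂; _,_; proj₁; proj₂)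
open import Data.Sum using (_⊎_; inj₁; inj₂)
open import Function using (_∘_)
open import Function.Bundles using (Equivalence)
open import Relation.Binary.PropositionalEquality using (_≡_; _≢_; refl; sym; trans; cong; cong₂)
open import Relation.Nullary using (¬_; Dec; yes; no)
open import Relation.Nullary.Decidable using (isYes≗does; dec-true)

Fin-⊈-shorter-list : ∀ {m} (xs : List (Fin m)) → length xs < m → ¬ (∀ x → x ∈ xs)
Fin-⊈-shorter-list xs len<m every = <⇒≱ len<m (injective⇒≤ index-injective)
  where
  index-injective : ∀ {x y} → Any.index (every x) ≡ Any.index (every y) → x ≡ y
  index-injective {x} {y} e =
    trans (lookup-index (every x)) (trans (cong (lookup xs) e) (sym (lookup-index (every y))))

fresh : ∀ {m} (xs : List (Fin m)) → length xs < m → ∃ λ x → All (x ≢_) xs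
fresh {m} xs len<m
  with x , x∉xs ← ¬∀⟶∃¬ m (_∈ xs) (λ x → Any.any? (x ≟_) xs) (Fin-⊈-shorter-list xs len<m)
  = x , ¬Any⇒All¬ xs x∉xs

Fin-two-distinct : ∀ {k} → 2 ≤ k → ∃₂ λ (i j : Fin k) → i ≢ j
Fin-two-distinct (s≤s (s≤s _)) = zero , suc zero , λ ()

module _ {A : Set} where

  distinct-members⇒2≤length : ∀ {x y : A} {xs} → x ∈ xs → y ∈ xs → x ≢ y → 2 ≤ length xs
  distinct-members⇒2≤length {xs = _ ∷ _ ∷ _} _           _           _   = s≤s (s≤s z≤n)
  distinct-members⇒2≤length {xs = _ ∷ []}    (here refl) (here refl) x≢y = ⊥-elim (x≢y refl)
  distinct-members⇒2≤length {xs = _ ∷ []}    (there ())  _           _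
  distinct-members⇒2≤length {xs = _ ∷ []}    _           (there ())  _

  2≤length⇒distinct-members : ∀ {xs : List A} → Unique xs → 2 ≤ length xs →
                              ∃₂ λ x y → x ≢ y × x ∈ xs × y ∈ xs
  2≤length⇒distinct-members {x ∷ y ∷ _} ((x≢y ∷ _) ∷ _) _ = x , y , x≢y , here refl , there (here refl)
  2≤length⇒distinct-members {_ ∷ []}    _               (s≤s ())

module Burning (G : FinGraph) (verts-unique : Unique (FinGraph.verts G))
               (verts-complete : ∀ v → v ∈ FinGraph.verts G) where

  open FinGraph G

  -- A record rather than a synonym for adj u v ≡ true: for concrete graphs adj computes,
  -- and u, v could then no longer be inferred from the type.
  record Adj (u v : V) : Set where
    constructor adjacent
    field adj≡true : adj u v ≡ true

  BlueNbr : (V → Bool) → V → V → Set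
  BlueNbr B v u = Adj v u × B u ≡ true

  TwoBlueNbrs : (V → Bool) → V → Set
  TwoBlueNbrs B v = ∃₂ λ u₁ u₂ → u₁ ≢ u₂ × BlueNbr B v u₁ × BlueNbr B v u₂

  module _ {B : V → Bool} {v : V} where

    private
      blueNbr? : ∀ u → Dec ((adj v u ∧ B u) ≡ true)
      blueNbr? u = (adj v u ∧ B u) ≟ᴮ true

    2≤blueNbrs⇒TwoBlueNbrs : (2 ≤ᵇ blueNbrs G B v) ≡ true → TwoBlueNbrs B v
    2≤blueNbrs⇒TwoBlueNbrs h
      with u₁ , u₂ , u₁≢u₂ , u₁∈ , u₂∈ ←
             2≤length⇒distinct-members (filter⁺ blueNbr? verts-unique) (≤ᵇ⇒≤ 2 _ (Equivalence.from T-≡ h))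
      = u₁ , u₂ , u₁≢u₂ , blueNbr u₁∈ , blueNbr u₂∈
      where
      blueNbr : ∀ {u} → u ∈ filter blueNbr? verts → BlueNbr B v u
      blueNbr u∈ = let h = proj₂ (∈-filter⁻ blueNbr? {xs = verts} u∈) in
                   adjacent (∧-conicalˡ _ _ h) , ∧-conicalʳ _ _ h

    TwoBlueNbrs⇒2≤blueNbrs : TwoBlueNbrs B v → (2 ≤ᵇ blueNbrs G B v) ≡ true
    TwoBlueNbrs⇒2≤blueNbrs (u₁ , u₂ , u₁≢u₂ , (a₁ , b₁) , (a₂ , b₂)) =
      Equivalence.to T-≡ (≤⇒≤ᵇ (distinct-members⇒2≤length (member a₁ b₁) (member a₂ b₂) u₁≢u₂))
      where
      member : ∀ {u} → Adj v u → B u ≡ true → u ∈ filter blueNbr? verts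
      member (adjacent a) b = ∈-filter⁺ blueNbr? (verts-complete _) (cong₂ _∧_ a b)

  module _ {s : List V} {v : V} where

    isSourceAt⇒srcAt : ∀ {j} → isSourceAt G s j v ≡ true → srcAt G s j ≡ just v
    isSourceAt⇒srcAt {j} h with srcAt G s j
    ... | just x with x ≟V v
    ...   | yes refl = refl

    srcAt⇒isSourceAt : ∀ {j} → srcAt G s j ≡ just v → isSourceAt G s j v ≡ true
    srcAt⇒isSourceAt e rewrite e = trans (isYes≗does (v ≟V v)) (dec-true (v ≟V v) refl)

    blue-suc⁻ : ∀ j → blue G s (suc j) v ≡ true →
                blue G s j v ≡ true ⊎ srcAt G s (suc j) ≡ just v ⊎ TwoBlueNbrs (blue G s j) v
    blue-suc⁻ j h
      with blue G s j v | isSourceAt G s (suc j) v in src | 2 ≤ᵇ blueNbrs G (blue G s j) v in two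
    ... | true  | _     | _    = inj₁ refl
    ... | false | true  | _    = inj₂ (inj₁ (isSourceAt⇒srcAt src))
    ... | false | false | true = inj₂ (inj₂ (2≤blueNbrs⇒TwoBlueNbrs two))

    blue-suc-mono : ∀ j → blue G s j v ≡ true → blue G s (suc j) v ≡ true
    blue-suc-mono _ h rewrite h = refl

    blue-source : ∀ j → srcAt G s (suc j) ≡ just v → blue G s (suc j) v ≡ true
    blue-source j e rewrite srcAt⇒isSourceAt e = ∨-zeroʳ (blue G s j v)

    blue-spread : ∀ j → TwoBlueNbrs (blue G s j) v → blue G s (suc j) v ≡ true
    blue-spread j two rewrite TwoBlueNbrs⇒2≤blueNbrs two =
      trans (cong (blue G s j v ∨_) (∨-zeroʳ _)) (∨-zeroʳ _)

  blue-mono : ∀ {s j k v} → j ≤ k → blue G s j v ≡ true → blue G s k v ≡ true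
  blue-mono = go ∘ ≤⇒≤′
    where
    go : ∀ {s j k v} → j ≤′ k → blue G s j v ≡ true → blue G s k v ≡ true
    go ≤′-refl           h = h
    go (≤′-step {k} j≤k) h = blue-suc-mono k (go j≤k h)

  AllBlue-mono : ∀ {s j k} → j ≤ k → AllBlue G s j → AllBlue G s k
  AllBlue-mono j≤k all v = blue-mono j≤k (all v)

  stays-white : ∀ {s v w} j (C : V → Set) → (∀ u → blue G s j u ≡ true → C u) → ¬ C v →
                srcAt G s (suc j) ≢ just v → (∀ u → Adj v u → C u → u ≡ w) →
                blue G s (suc j) v ≢ true
  stays-white j C blue⊆C v∉C not-source one-nbr h with blue-suc⁻ j h
  ... | inj₁ blue-v        = v∉C (blue⊆C _ blue-v)
  ... | inj₂ (inj₁ source) = not-source source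
  ... | inj₂ (inj₂ (u₁ , u₂ , u₁≢u₂ , (a₁ , b₁) , (a₂ , b₂))) =
    u₁≢u₂ (trans (one-nbr u₁ a₁ (blue⊆C u₁ b₁)) (sym (one-nbr u₂ a₂ (blue⊆C u₂ b₂))))

  no-later-source : ∀ {s v} j → length s ≤ 1 → srcAt G s (suc (suc j)) ≢ just v
  no-later-source {[]}        _ _        ()
  no-later-source {_ ∷ []}    _ _        ()
  no-later-source {_ ∷ _ ∷ _} _ (s≤s ())

  short-blue⇒first-source : ∀ {s v} → length s ≤ 1 → ∀ j → blue G s j v ≡ true → srcAt G s 1 ≡ just v
  short-blue⇒first-source {s} short (suc j) h with blue-suc⁻ j h
  ... | inj₁ blue-v = short-blue⇒first-source {s} short j blue-v
  ... | inj₂ (inj₂ (u₁ , u₂ , u₁≢u₂ , (_ , b₁) , (_ , b₂))) =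
    ⊥-elim (u₁≢u₂ (just-injective (trans (sym (short-blue⇒first-source {s} short j b₁))
                                         (short-blue⇒first-source {s} short j b₂))))
  short-blue⇒first-source     short (suc zero)    h | inj₂ (inj₁ source) = source
  short-blue⇒first-source {s} short (suc (suc j)) h | inj₂ (inj₁ source) =
    ⊥-elim (no-later-source {s} j short source)

  short-never-burns : ∀ {s j u v} → length s ≤ 1 → u ≢ v → ¬ AllBlue G s j
  short-never-burns {s} {j} short u≢v all =
    u≢v (just-injective (trans (sym (short-blue⇒first-source {s} short j (all _)))
                               (short-blue⇒first-source {s} short j (all _))))

  data Early (w₁ w₂ : V) : V → Set where
    first  : Early w₁ w₂ w₁
    second : Early w₁ w₂ w₂
    common : ∀ {v} → w₁ ≢ w₂ → Adj v w₁ → Adj v w₂ → Early w₁ w₂ v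

  module _ {w₁ w₂ : V} {rest : List V} where

    blue₁ : ∀ {v} → blue G (w₁ ∷ rest) 1 v ≡ true → v ≡ w₁
    blue₁ h with blue-suc⁻ {s = w₁ ∷ rest} 0 h
    ... | inj₂ (inj₁ source) = sym (just-injective source)

    blue₂ : ∀ {v} → blue G (w₁ ∷ w₂ ∷ rest) 2 v ≡ true → v ≡ w₁ ⊎ v ≡ w₂
    blue₂ h with blue-suc⁻ {s = w₁ ∷ w₂ ∷ rest} 1 h
    ... | inj₁ blue-v        = inj₁ (blue₁ blue-v)
    ... | inj₂ (inj₁ source) = inj₂ (sym (just-injective source))
    ... | inj₂ (inj₂ (_ , _ , u₁≢u₂ , (_ , b₁) , (_ , b₂))) =
      ⊥-elim (u₁≢u₂ (trans (blue₁ b₁) (sym (blue₁ b₂))))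

    blue₃ : ∀ {v} → blue G (w₁ ∷ w₂ ∷ rest) 3 v ≡ true → Early w₁ w₂ v ⊎ srcAt G rest 1 ≡ just v
    blue₃ h with blue-suc⁻ {s = w₁ ∷ w₂ ∷ rest} 2 h
    ... | inj₁ blue-v with blue₂ blue-v
    ...   | inj₁ refl = inj₁ first
    ...   | inj₂ refl = inj₁ second
    blue₃ h | inj₂ (inj₁ source) = inj₂ source
    blue₃ h | inj₂ (inj₂ (u₁ , u₂ , u₁≢u₂ , (a₁ , b₁) , (a₂ , b₂))) with blue₂ b₁ | blue₂ b₂
    ... | inj₁ refl | inj₁ refl = ⊥-elim (u₁≢u₂ refl)
    ... | inj₁ refl | inj₂ refl = inj₁ (common u₁≢u₂ a₁ a₂)
    ... | inj₂ refl | inj₁ refl = inj₁ (common (u₁≢u₂ ∘ sym) a₂ a₁)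
    ... | inj₂ refl | inj₂ refl = ⊥-elim (u₁≢u₂ refl)

  isRd-intro : ∀ {s b} → AllBlue G s (suc b) → ¬ AllBlue G s b → IsRd G s (suc b)
  isRd-intro burnt not-burnt = burnt , λ r r≤b burnt-r → not-burnt (AllBlue-mono (≤-pred r≤b) burnt-r)

  isB2-intro : ∀ {s b} → IsRd G s (suc b) → (∀ s′ → ¬ AllBlue G s′ b) → IsB2 G (suc b)
  isB2-intro {s} rd never = (s , rd) , λ s′ r (burnt , _) →
    ≮⇒≥ (λ r≤b → never s′ (AllBlue-mono (≤-pred r≤b) burnt))

  isT2-intro : ∀ {s b} → IsRd G s b → (∀ s′ → length s′ < length s → ¬ AllBlue G s′ b) →
               IsT2 G b (length s)
  isT2-intro {s} rd shorter-fail = (s , rd , refl) , λ s′ (burnt , _) →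
    ≮⇒≥ (λ shorter → shorter-fail s′ shorter burnt)

Large : ℕ → ℕ → Set
Large m n = 4 ≤ m × 3 ≤ n × (5 ≤ m ⊎ 4 ≤ n)

Large⇒2≤m : ∀ {m n} → Large m n → 2 ≤ m
Large⇒2≤m (4≤m , _) = ≤-trans (m≤m+n 2 2) 4≤m

Large⇒2≤n : ∀ {m n} → Large m n → 2 ≤ n
Large⇒2≤n (_ , 3≤n , _) = ≤-trans (n≤1+n 2) 3≤n

Large-intro : ∀ {m n} → (5 ≤ m × n ≡ 3) ⊎ (n ≤ m × 4 ≤ n) → Large m n
Large-intro (inj₁ (5≤m , refl)) = <⇒≤ 5≤m , ≤-refl , inj₁ 5≤m
Large-intro (inj₂ (n≤m , 4≤n))  = ≤-trans 4≤n n≤m , <⇒≤ 4≤n , inj₂ 4≤n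

module RookGraph (m n : ℕ) where

  G : FinGraph
  G = KK m n

  open FinGraph G using (V; adj; verts)

  KK-verts-unique : Unique verts
  KK-verts-unique = cartesianProduct⁺ (allFin⁺ m) (allFin⁺ n)

  KK-verts-complete : ∀ v → v ∈ verts
  KK-verts-complete (a , b) = ∈-cartesianProduct⁺ (∈-allFin a) (∈-allFin b)

  open Burning G KK-verts-unique KK-verts-complete public

  data Rook : V → V → Set where
    sameRow : ∀ {a b d} → b ≢ d → Rook (a , b) (a , d)
    sameCol : ∀ {a b c} → a ≢ c → Rook (a , b) (c , b)

  adj⇒Rook : ∀ {u v} → Adj u v → Rook u v
  adj⇒Rook {a , b} {c , d} (adjacent h) with a ≟ c | b ≟ d
  ... | yes refl | no b≢d   = sameRow b≢d
  ... | no a≢c   | yes refl = sameCol a≢c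

  Rook⇒adj : ∀ {u v} → Rook u v → Adj u v
  Rook⇒adj r = adjacent (adj-true r)
    where
    adj-true : ∀ {u v} → Rook u v → adj u v ≡ true
    adj-true (sameRow {a} {b} {d} b≢d) with a ≟ a | b ≟ d
    ... | yes _   | no _    = refl
    ... | no a≢a  | _       = ⊥-elim (a≢a refl)
    ... | _       | yes b≡d = ⊥-elim (b≢d b≡d)
    adj-true (sameCol {a} {b} {c} a≢c) with a ≟ c | b ≟ b
    ... | no _    | yes _   = refl
    ... | _       | no b≢b  = ⊥-elim (b≢b refl)
    ... | yes a≡c | _       = ⊥-elim (a≢c a≡c)

  data Shape : Set where
    row  : Fin m → Shape
    col  : Fin n → Shape
    rect : Fin m → Fin m → Fin n → Fin n → Shape

  _∈ₛ_ : V → Shape → Set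
  (x , _) ∈ₛ row a            = x ≡ a
  (_ , y) ∈ₛ col b            = y ≡ b
  (x , y) ∈ₛ rect a₁ a₂ b₁ b₂ = (x ≡ a₁ ⊎ x ≡ a₂) × (y ≡ b₁ ⊎ y ≡ b₂)

  early⊆row : ∀ {a b₁ b₂ v} → Early (a , b₁) (a , b₂) v → v ∈ₛ row a
  early⊆row first  = refl
  early⊆row second = refl
  early⊆row (common w₁≢w₂ adj₁ adj₂) with adj⇒Rook adj₁ | adj⇒Rook adj₂
  ... | sameRow _ | _         = refl
  ... | sameCol _ | sameRow _ = refl
  ... | sameCol _ | sameCol _ = ⊥-elim (w₁≢w₂ refl)

  early⊆col : ∀ {a₁ a₂ b v} → Early (a₁ , b) (a₂ , b) v → v ∈ₛ col b
  early⊆col first  = refl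
  early⊆col second = refl
  early⊆col (common w₁≢w₂ adj₁ adj₂) with adj⇒Rook adj₁ | adj⇒Rook adj₂
  ... | sameCol _ | _         = refl
  ... | sameRow _ | sameCol _ = refl
  ... | sameRow _ | sameRow _ = ⊥-elim (w₁≢w₂ refl)

  early⊆rect : ∀ {a₁ a₂ b₁ b₂ v} → a₁ ≢ a₂ → b₁ ≢ b₂ →
               Early (a₁ , b₁) (a₂ , b₂) v → v ∈ₛ rect a₁ a₂ b₁ b₂
  early⊆rect _ _ first  = inj₁ refl , inj₁ refl
  early⊆rect _ _ second = inj₂ refl , inj₂ refl
  early⊆rect a₁≢a₂ b₁≢b₂ (common _ adj₁ adj₂) with adj⇒Rook adj₁ | adj⇒Rook adj₂
  ... | sameRow _ | sameRow _ = ⊥-elim (a₁≢a₂ refl)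
  ... | sameRow _ | sameCol _ = inj₁ refl , inj₂ refl
  ... | sameCol _ | sameRow _ = inj₂ refl , inj₁ refl
  ... | sameCol _ | sameCol _ = ⊥-elim (b₁≢b₂ refl)

  early-confined : ∀ w₁ w₂ → ∃ λ S → ∀ {v} → Early w₁ w₂ v → v ∈ₛ S
  early-confined (a₁ , b₁) (a₂ , b₂) with a₁ ≟ a₂ | b₁ ≟ b₂
  ... | yes refl | _        = row a₁ , early⊆row
  ... | no _     | yes refl = col b₁ , early⊆col
  ... | no a₁≢a₂ | no b₁≢b₂ = rect a₁ a₂ b₁ b₂ , early⊆rect a₁≢a₂ b₁≢b₂

  Covered : Shape → V → V → Set
  Covered S p u = u ∈ₛ S ⊎ u ≡ p

  Lonely : Shape → V → V → V → Set
  Lonely S p q v = ¬ Covered S p v × v ≢ q × ∃ λ w → ∀ {u} → Rook v u → Covered S p u → u ≡ w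

  module _ {x r₃ r₄ : Fin m} {y c₃ c₄ : Fin n} where

    lonely-row : ∀ {a} → x ≢ a → x ≢ r₃ → x ≢ r₄ → y ≢ c₃ →
                 Lonely (row a) (r₃ , c₃) (r₄ , c₄) (x , y)
    lonely-row {a} x≢a x≢r₃ x≢r₄ y≢c₃ = uncovered , x≢r₄ ∘ cong proj₁ , (a , y) , only
      where
      uncovered : ¬ Covered (row a) (r₃ , c₃) (x , y)
      uncovered (inj₁ x≡a) = x≢a x≡a
      uncovered (inj₂ v≡p) = x≢r₃ (cong proj₁ v≡p)
      only : ∀ {u} → Rook (x , y) u → Covered (row a) (r₃ , c₃) u → u ≡ (a , y)
      only (sameRow _) (inj₁ x≡a) = ⊥-elim (x≢a x≡a)
      only (sameRow _) (inj₂ u≡p) = ⊥-elim (x≢r₃ (cong proj₁ u≡p))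
      only (sameCol _) (inj₁ c≡a) = cong (_, y) c≡a
      only (sameCol _) (inj₂ u≡p) = ⊥-elim (y≢c₃ (cong proj₂ u≡p))

    lonely-col : ∀ {b} → y ≢ b → x ≢ r₃ → x ≢ r₄ → y ≢ c₃ →
                 Lonely (col b) (r₃ , c₃) (r₄ , c₄) (x , y)
    lonely-col {b} y≢b x≢r₃ x≢r₄ y≢c₃ = uncovered , x≢r₄ ∘ cong proj₁ , (x , b) , only
      where
      uncovered : ¬ Covered (col b) (r₃ , c₃) (x , y)
      uncovered (inj₁ y≡b) = y≢b y≡b
      uncovered (inj₂ v≡p) = x≢r₃ (cong proj₁ v≡p)
      only : ∀ {u} → Rook (x , y) u → Covered (col b) (r₃ , c₃) u → u ≡ (x , b)
      only (sameRow _) (inj₁ d≡b) = cong (x ,_) d≡b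
      only (sameRow _) (inj₂ u≡p) = ⊥-elim (x≢r₃ (cong proj₁ u≡p))
      only (sameCol _) (inj₁ y≡b) = ⊥-elim (y≢b y≡b)
      only (sameCol _) (inj₂ u≡p) = ⊥-elim (y≢c₃ (cong proj₂ u≡p))

    lonely-rect : ∀ {a₁ a₂ b₁ b₂} → x ≢ a₁ → x ≢ a₂ → x ≢ r₃ → y ≢ b₁ → y ≢ b₂ →
                  x ≢ r₄ ⊎ y ≢ c₄ → Lonely (rect a₁ a₂ b₁ b₂) (r₃ , c₃) (r₄ , c₄) (x , y)
    lonely-rect {a₁} {a₂} {b₁} {b₂} x≢a₁ x≢a₂ x≢r₃ y≢b₁ y≢b₂ x≢r₄⊎y≢c₄ =
      uncovered , not-fourth x≢r₄⊎y≢c₄ , (r₃ , c₃) , only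
      where
      x∉ : ¬ (x ≡ a₁ ⊎ x ≡ a₂)
      x∉ (inj₁ x≡a₁) = x≢a₁ x≡a₁
      x∉ (inj₂ x≡a₂) = x≢a₂ x≡a₂
      y∉ : ¬ (y ≡ b₁ ⊎ y ≡ b₂)
      y∉ (inj₁ y≡b₁) = y≢b₁ y≡b₁
      y∉ (inj₂ y≡b₂) = y≢b₂ y≡b₂
      uncovered : ¬ Covered (rect a₁ a₂ b₁ b₂) (r₃ , c₃) (x , y)
      uncovered (inj₁ (x∈ , _)) = x∉ x∈
      uncovered (inj₂ v≡p)      = x≢r₃ (cong proj₁ v≡p)
      not-fourth : x ≢ r₄ ⊎ y ≢ c₄ → (x , y) ≢ (r₄ , c₄)
      not-fourth (inj₁ x≢r₄) = x≢r₄ ∘ cong proj₁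
      not-fourth (inj₂ y≢c₄) = y≢c₄ ∘ cong proj₂
      only : ∀ {u} → Rook (x , y) u → Covered (rect a₁ a₂ b₁ b₂) (r₃ , c₃) u → u ≡ (r₃ , c₃)
      only _           (inj₂ u≡p)      = u≡p
      only (sameRow _) (inj₁ (x∈ , _)) = ⊥-elim (x∉ x∈)
      only (sameCol _) (inj₁ (_ , y∈)) = ⊥-elim (y∉ y∈)

  escape : Large m n → ∀ S p q → ∃ (Lonely S p q)
  escape (4≤m , 3≤n , _) (row a) (r₃ , c₃) (r₄ , c₄)
    with x , x≢a ∷ x≢r₃ ∷ x≢r₄ ∷ [] ← fresh (a ∷ r₃ ∷ r₄ ∷ []) 4≤m
       | y , y≢c₃ ∷ []               ← fresh (c₃ ∷ []) (<⇒≤ 3≤n)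
    = (x , y) , lonely-row x≢a x≢r₃ x≢r₄ y≢c₃
  escape (4≤m , 3≤n , _) (col b) (r₃ , c₃) (r₄ , c₄)
    with x , x≢r₃ ∷ x≢r₄ ∷ [] ← fresh (r₃ ∷ r₄ ∷ []) (<⇒≤ 4≤m)
       | y , y≢b ∷ y≢c₃ ∷ []  ← fresh (b ∷ c₃ ∷ []) 3≤n
    = (x , y) , lonely-col y≢b x≢r₃ x≢r₄ y≢c₃
  escape (_ , 3≤n , inj₁ 5≤m) (rect a₁ a₂ b₁ b₂) (r₃ , c₃) (r₄ , c₄)
    with x , x≢a₁ ∷ x≢a₂ ∷ x≢r₃ ∷ x≢r₄ ∷ [] ← fresh (a₁ ∷ a₂ ∷ r₃ ∷ r₄ ∷ []) 5≤m
       | y , y≢b₁ ∷ y≢b₂ ∷ []                ← fresh (b₁ ∷ b₂ ∷ []) 3≤n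
    = (x , y) , lonely-rect x≢a₁ x≢a₂ x≢r₃ y≢b₁ y≢b₂ (inj₁ x≢r₄)
  escape (4≤m , _ , inj₂ 4≤n) (rect a₁ a₂ b₁ b₂) (r₃ , c₃) (r₄ , c₄)
    with x , x≢a₁ ∷ x≢a₂ ∷ x≢r₃ ∷ []        ← fresh (a₁ ∷ a₂ ∷ r₃ ∷ []) 4≤m
       | y , y≢b₁ ∷ y≢b₂ ∷ y≢c₄ ∷ []        ← fresh (b₁ ∷ b₂ ∷ c₄ ∷ []) 4≤n
    = (x , y) , lonely-rect x≢a₁ x≢a₂ x≢r₃ y≢b₁ y≢b₂ (inj₂ y≢c₄)

  two-sources-needed : 2 ≤ m → 0 < n → ∀ {s j} → length s ≤ 1 → ¬ AllBlue G s j
  two-sources-needed 2≤m 0<n {s} {j} short with a₀ , a₁ , a₀≢a₁ ← Fin-two-distinct 2≤m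
    = short-never-burns {s} {j} {u = a₀ , fromℕ< 0<n} {v = a₁ , fromℕ< 0<n} short (a₀≢a₁ ∘ cong proj₁)

  -- A missing third or fourth source is replaced by w₁; any stand-in would do.
  blue₃-covered : ∀ {w₁ w₂ rest S} → (∀ {v} → Early w₁ w₂ v → v ∈ₛ S) →
                  ∀ u → blue G (w₁ ∷ w₂ ∷ rest) 3 u ≡ true → Covered S (fromMaybe w₁ (srcAt G rest 1)) u
  blue₃-covered {w₁} {w₂} {rest} early⊆S u h with blue₃ {w₁} {w₂} {rest} h
  ... | inj₁ early  = inj₁ (early⊆S early)
  ... | inj₂ source = inj₂ (sym (cong (fromMaybe w₁) source))

  not-burnt-by-4 : Large m n → ∀ s → ¬ AllBlue G s 4
  not-burnt-by-4 large [] =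
    two-sources-needed (Large⇒2≤m large) (<⇒≤ (Large⇒2≤n large)) {[]} {4} z≤n
  not-burnt-by-4 large (w ∷ []) =
    two-sources-needed (Large⇒2≤m large) (<⇒≤ (Large⇒2≤n large)) {w ∷ []} {4} (s≤s z≤n)
  not-burnt-by-4 large (w₁ ∷ w₂ ∷ rest) burnt
    with S , early⊆S ← early-confined w₁ w₂
    with v , uncovered , v≢fourth , w , only ←
           escape large S (fromMaybe w₁ (srcAt G rest 1)) (fromMaybe w₁ (srcAt G rest 2))
    = stays-white {s = w₁ ∷ w₂ ∷ rest} 3 _ (blue₃-covered {w₁} {w₂} {rest} early⊆S) uncovered
        (v≢fourth ∘ sym ∘ cong (fromMaybe w₁)) (λ _ → only ∘ adj⇒Rook) (burnt v)

  blue-rook-spread : ∀ {s} j {v u₁ u₂} → u₁ ≢ u₂ → Rook v u₁ → Rook v u₂ →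
                     blue G s j u₁ ≡ true → blue G s j u₂ ≡ true → blue G s (suc j) v ≡ true
  blue-rook-spread j u₁≢u₂ r₁ r₂ b₁ b₂ =
    blue-spread j (_ , _ , u₁≢u₂ , (Rook⇒adj r₁ , b₁) , (Rook⇒adj r₂ , b₂))

  fill-row : ∀ {s} j {a b₁ b₂} → b₁ ≢ b₂ → blue G s j (a , b₁) ≡ true → blue G s j (a , b₂) ≡ true →
             ∀ b → blue G s (suc j) (a , b) ≡ true
  fill-row j {b₁ = b₁} {b₂} b₁≢b₂ h₁ h₂ b with b ≟ b₁ | b ≟ b₂
  ... | yes refl | _        = blue-suc-mono j h₁
  ... | no _     | yes refl = blue-suc-mono j h₂
  ... | no b≢b₁  | no b≢b₂  =
    blue-rook-spread j (b₁≢b₂ ∘ cong proj₂) (sameRow b≢b₁) (sameRow b≢b₂) h₁ h₂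

  fill-col : ∀ {s} j {a₁ a₂ b} → a₁ ≢ a₂ → blue G s j (a₁ , b) ≡ true → blue G s j (a₂ , b) ≡ true →
             ∀ a → blue G s (suc j) (a , b) ≡ true
  fill-col j {a₁} {a₂} a₁≢a₂ h₁ h₂ a with a ≟ a₁ | a ≟ a₂
  ... | yes refl | _        = blue-suc-mono j h₁
  ... | no _     | yes refl = blue-suc-mono j h₂
  ... | no a≢a₁  | no a≢a₂  =
    blue-rook-spread j (a₁≢a₂ ∘ cong proj₁) (sameCol a≢a₁) (sameCol a≢a₂) h₁ h₂

  module _ {a₀ a₁ : Fin m} {b₀ b₁ : Fin n} (a₀≢a₁ : a₀ ≢ a₁) (b₀≢b₁ : b₀ ≢ b₁) where

    diagonal : List V
    diagonal = (a₀ , b₀) ∷ (a₁ , b₁) ∷ []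

    diagonal-burns-in-5 : AllBlue G diagonal 5
    diagonal-burns-in-5 (x , y) = fill-col {diagonal} 4 a₀≢a₁ (row₀ y) (row₁ y) x
      where
      sources-distinct : (a₀ , b₀) ≢ (a₁ , b₁)
      sources-distinct = a₀≢a₁ ∘ cong proj₁
      first₂ : blue G diagonal 2 (a₀ , b₀) ≡ true
      first₂ = blue-suc-mono {diagonal} 1 (blue-source {diagonal} 0 refl)
      second₂ : blue G diagonal 2 (a₁ , b₁) ≡ true
      second₂ = blue-source {diagonal} 1 refl
      corner₀₀ : blue G diagonal 3 (a₀ , b₀) ≡ true
      corner₀₀ = blue-suc-mono {diagonal} 2 first₂
      corner₁₁ : blue G diagonal 3 (a₁ , b₁) ≡ true
      corner₁₁ = blue-suc-mono {diagonal} 2 second₂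
      corner₀₁ : blue G diagonal 3 (a₀ , b₁) ≡ true
      corner₀₁ = blue-rook-spread {diagonal} 2 sources-distinct
                   (sameRow (b₀≢b₁ ∘ sym)) (sameCol a₀≢a₁) first₂ second₂
      corner₁₀ : blue G diagonal 3 (a₁ , b₀) ≡ true
      corner₁₀ = blue-rook-spread {diagonal} 2 sources-distinct
                   (sameCol (a₀≢a₁ ∘ sym)) (sameRow b₀≢b₁) first₂ second₂
      row₀ : ∀ b → blue G diagonal 4 (a₀ , b) ≡ true
      row₀ = fill-row {diagonal} 3 b₀≢b₁ corner₀₀ corner₀₁
      row₁ : ∀ b → blue G diagonal 4 (a₁ , b) ≡ true
      row₁ = fill-row {diagonal} 3 b₀≢b₁ corner₁₀ corner₁₁

theorem5 : (m n : ℕ) → ((5 ≤ m × n ≡ 3) ⊎ (n ≤ m × 4 ≤ n)) →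
    IsT2 (KK m n) 5 2 × IsB2 (KK m n) 5
theorem5 m n size =
  let (_ , _ , a₀≢a₁) = Fin-two-distinct (Large⇒2≤m large)
      (_ , _ , b₀≢b₁) = Fin-two-distinct (Large⇒2≤n large)
      s₀ = diagonal a₀≢a₁ b₀≢b₁
      optimal = isRd-intro {s₀} (diagonal-burns-in-5 a₀≢a₁ b₀≢b₁) (not-burnt-by-4 large s₀)
  in isT2-intro optimal (λ s shorter →
       two-sources-needed (Large⇒2≤m large) (<⇒≤ (Large⇒2≤n large)) {s} {5} (≤-pred shorter)) ,
     isB2-intro optimal (not-burnt-by-4 large)
  where
  open RookGraph m n
  large : Large m n
  large = Large-intro size
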